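{- Let $X=\prod_{s\in S}X_s$. Any basis $Y$ of a closed subset of $X$ satisfies $$|Y|\le|X|-\prod_{s\in S}(|X_s|-1)\le|X|\cdot\sum_{s\in S}1/|X_s|.$$
   Context: Fix a prime $\ell$, a positive integer $k_0$, $\mathbb Z_\ell[\xi]=\mathbb Z_\ell[x]/(1+x^{\ell^{k_0-1}}+\dots+x^{(\ell-1)\ell^{k_0-1}})$. $S$ is a nonempty finite set, the $X_s$ are disjoint nonempty finite sets, $X=\prod_sX_s$. An $s$-line is a subset $X_s\times\prod_{t\ne s}\{x_{0t}\}$. For $Y\subseteq X$, $\mathrm{zs}(Y)$ is the module of $a:Y\to\mathbb Z_\ell[\xi]$ with $\sum_{x\in L\cap Y}a(x)=0$ for every $s$-line $L$ and every $s\in S$. Functions on $Y\subseteq Y'$ extend by zero. The closure $\overline Y$ is the maximal $Y\subseteq\overline Y\subseteq X$ with $\mathbb Z_\ell[\xi]^Y/\mathrm{zs}(Y)\to\mathbb Z_\ell[\xi]^{\overline Y}/\mathrm{zs}(\overline Y)$ surjective; $Y$ is closed if $\overline Y=Y$; a basis of a closed set $Z$ is a minimal subset of $Z$ with closure $Z$. -}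

module Defs where

open import Data.Nat as ℕ using (ℕ; zero; suc)
open import Data.Integer as ℤ using (ℤ; 0ℤ; +_)
open import Data.Integer.Tactic.RingSolver using (solve-∀)
open import Data.Fin using (Fin)
open import Data.Bool using (Bool; true; false; if_then_else_; T)
open import Data.List using (List; []; _∷_; length; lookup; foldr; map; allFin; concatMap)
open import Data.Product using (Σ; _×_; _,_; ∃)
open import Data.Unit using (⊤; tt)
open import Relation.Binary.PropositionalEquality using (_≡_; refl; trans; cong)

-- ℓ-adic integers ℤ_ℓ as compatible sequences of integers:
-- a sequence (a n) with a (n+1) ≡ a n (mod ℓ^n); two such sequences
-- are equal iff a n ≡ b n (mod ℓ^n) for every n.

_≡_[mod_] : ℤ → ℤ → ℕ → Set
a ≡ b [mod m ] = ∃ λ (q : ℤ) → a ≡ b ℤ.+ q ℤ.* (+ m)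

record ℤ[_] (ℓ : ℕ) : Set where
  constructor mkℤℓ
  field
    seq    : ℕ → ℤ
    compat : ∀ n → seq (suc n) ≡ seq n [mod ℓ ℕ.^ n ]
open ℤ[_] public

module _ {ℓ : ℕ} where

  _≈ℓ_ : ℤ[ ℓ ] → ℤ[ ℓ ] → Set
  a ≈ℓ b = ∀ n → seq a n ≡ seq b n [mod ℓ ℕ.^ n ]

  private
    lem0 : ∀ (m : ℤ) → 0ℤ ≡ 0ℤ ℤ.+ 0ℤ ℤ.* m
    lem0 = solve-∀
    lem+ : ∀ (a a' b b' q r m : ℤ) → a' ≡ a ℤ.+ q ℤ.* m → b' ≡ b ℤ.+ r ℤ.* m →
           a' ℤ.+ b' ≡ (a ℤ.+ b) ℤ.+ (q ℤ.+ r) ℤ.* m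
    lem+ a a' b b' q r m refl refl = eq a b q r m
      where
      eq : ∀ (a b q r m : ℤ) → (a ℤ.+ q ℤ.* m) ℤ.+ (b ℤ.+ r ℤ.* m) ≡ (a ℤ.+ b) ℤ.+ (q ℤ.+ r) ℤ.* m
      eq = solve-∀
    lem- : ∀ (a a' q m : ℤ) → a' ≡ a ℤ.+ q ℤ.* m → ℤ.- a' ≡ ℤ.- a ℤ.+ (ℤ.- q) ℤ.* m
    lem- a a' q m refl = eq a q m
      where
      eq : ∀ (a q m : ℤ) → ℤ.- (a ℤ.+ q ℤ.* m) ≡ ℤ.- a ℤ.+ (ℤ.- q) ℤ.* m
      eq = solve-∀

  0ℓ : ℤ[ ℓ ]
  0ℓ = mkℤℓ (λ _ → 0ℤ) (λ n → 0ℤ , lem0 (+ (ℓ ℕ.^ n)))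

  _+ℓ_ : ℤ[ ℓ ] → ℤ[ ℓ ] → ℤ[ ℓ ]
  a +ℓ b = mkℤℓ (λ n → seq a n ℤ.+ seq b n) c
    where
    c : ∀ n → _
    c n with compat a n | compat b n
    ... | q , p | r , p' = (q ℤ.+ r) , lem+ (seq a n) _ (seq b n) _ q r (+ (ℓ ℕ.^ n)) p p'

  -ℓ_ : ℤ[ ℓ ] → ℤ[ ℓ ]
  -ℓ a = mkℤℓ (λ n → ℤ.- seq a n) c
    where
    c : ∀ n → _
    c n with compat a n
    ... | q , p = ℤ.- q , lem- (seq a n) _ q (+ (ℓ ℕ.^ n)) p

-- The ring ℤ_ℓ[ξ] = ℤ_ℓ[x]/(Φ_{ℓ^k₀}(x)).  Since Φ_{ℓ^k₀} is monic of
-- degree d = (ℓ-1)ℓ^(k₀-1), its underlying additive group (all that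
-- enters the definition of zs, of the quotient maps and of the closure)
-- is free over ℤ_ℓ with basis 1, ξ, …, ξ^(d-1): elements are coefficient
-- vectors Fin d → ℤ_ℓ, with coordinatewise addition and equality.

deg : ℕ → ℕ → ℕ
deg ℓ k₀ = (ℓ ℕ.∸ 1) ℕ.* ℓ ℕ.^ (k₀ ℕ.∸ 1)

record Rξ (ℓ k₀ : ℕ) : Set where
  constructor mkR
  field coeff : Fin (deg ℓ k₀) → ℤ[ ℓ ]
open Rξ public

module _ {ℓ k₀ : ℕ} where
  _≈R_ : Rξ ℓ k₀ → Rξ ℓ k₀ → Set
  a ≈R b = ∀ i → coeff a i ≈ℓ coeff b i

  0R : Rξ ℓ k₀
  0R = mkR (λ _ → 0ℓ)

  _+R_ : Rξ ℓ k₀ → Rξ ℓ k₀ → Rξ ℓ k₀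
  a +R b = mkR (λ i → coeff a i +ℓ coeff b i)

  _-R_ : Rξ ℓ k₀ → Rξ ℓ k₀ → Rξ ℓ k₀
  a -R b = mkR (λ i → coeff a i +ℓ (-ℓ coeff b i))

-- S = Fin (length ns) and X_s = Fin (suc n_s)
-- where n_s is the s-th entry of ns (so each X_s is nonempty, |X_s| = n_s + 1;
-- the X_s are made disjoint by their index s).

Size : (ns : List ℕ) → Fin (length ns) → ℕ
Size ns s = suc (lookup ns s)

Pt : List ℕ → Set
Pt []       = ⊤
Pt (n ∷ ns) = Fin (suc n) × Pt ns

update : (ns : List ℕ) → Pt ns → (s : Fin (length ns)) → Fin (Size ns s) → Pt ns
update (n ∷ ns) (x , xs) Fin.zero    i = i , xs
update (n ∷ ns) (x , xs) (Fin.suc s) i = x , update ns xs s i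

allPts : (ns : List ℕ) → List (Pt ns)
allPts []       = tt ∷ []
allPts (n ∷ ns) = concatMap (λ i → map (i ,_) (allPts ns)) (allFin (suc n))

Subset : List ℕ → Set
Subset ns = Pt ns → Bool

card : {ns : List ℕ} → Subset ns → ℕ
card {ns} Y = foldr (λ x c → if Y x then suc c else c) 0 (allPts ns)

_⊆_ : {ns : List ℕ} → Subset ns → Subset ns → Set
Y ⊆ Z = ∀ x → T (Y x) → T (Z x)

module _ {ℓ k₀ : ℕ} {ns : List ℕ} where

  -- an element of ℤ_ℓ[ξ]^Y, viewed (extension by zero) as a function on X
  -- vanishing outside Y
  FunOn : Subset ns → (Pt ns → Rξ ℓ k₀) → Set
  FunOn Y a = ∀ x → Y x ≡ false → a x ≈R 0R

  lineSum : Subset ns → (Pt ns → Rξ ℓ k₀) → (s : Fin (length ns)) → Pt ns → Rξ ℓ k₀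
  lineSum Y a s x₀ =
    foldr (λ i acc → (if Y (update ns x₀ s i) then a (update ns x₀ s i) else 0R) +R acc)
          0R (allFin (Size ns s))

  InZs : Subset ns → (Pt ns → Rξ ℓ k₀) → Set
  InZs Y a = FunOn Y a × (∀ s x₀ → lineSum Y a s x₀ ≈R 0R)

  -- for Y ⊆ Y': the map ℤ_ℓ[ξ]^Y / zs(Y) → ℤ_ℓ[ξ]^Y' / zs(Y') induced by
  -- extension by zero is surjective
  QuotSurj : Subset ns → Subset ns → Set
  QuotSurj Y Y' = ∀ b → FunOn Y' b →
    Σ (Pt ns → Rξ ℓ k₀) λ a → FunOn Y a × InZs Y' (λ x → a x -R b x)

  IsClosure : Subset ns → Subset ns → Set
  IsClosure Y Ybar = (Y ⊆ Ybar) × QuotSurj Y Ybar ×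
    (∀ Z → Y ⊆ Z → QuotSurj Y Z → Z ⊆ Ybar)

  IsClosed : Subset ns → Set
  IsClosed Z = IsClosure Z Z

  IsBasis : Subset ns → Subset ns → Set
  IsBasis Y Z = (Y ⊆ Z) × IsClosure Y Z × (∀ Y' → Y' ⊆ Y → IsClosure Y' Z → Y ⊆ Y')

module Submission where

-- For q in the interior ∏_s (X_s ∖ {0}), the functions E q = ⊗_s (δ_{q_s} − δ_0) have zero line
-- sums, and on interior points E q is the indicator of q.  If |Y| + ∏_s (|X_s| − 1) > |X|, the E q
-- and the indicators of the points of Y are linearly dependent over ℤ; dividing the relation by ℓ
-- as long as possible leaves a coefficient prime to ℓ.  This produces an integer-valued zero-sum
-- function G supported on Y whose value at some y ∈ Y is a unit of ℤ_ℓ.  Subtracting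
-- (a(y) / G(y)) · G from any representative a then moves it off y, so Y ∖ {y} has the same closure
-- as Y, contradicting the minimality of a basis.  The second inequality is the Weierstrass product
-- inequality ∏_s (1 − 1/|X_s|) ≥ 1 − Σ_s 1/|X_s|.

open import Defs

open import Data.Bool using (Bool; true; false; if_then_else_; T; T?)
open import Data.Empty using (⊥-elim)
open import Data.Fin as F using (Fin; punchIn; _↑ˡ_; _↑ʳ_)
open import Data.Fin.Properties as FP using (all?; ¬∀⟶∃¬; punchInᵢ≢i)
open import Data.Integer as ℤ using (ℤ; 0ℤ; 1ℤ; +_; ∣_∣)
open import Data.Integer.DivMod using (_%ℕ_; _/ℕ_; n%ℕd<d; a≡a%ℕn+[a/ℕn]*n)
open import Data.Integer.Divisibility.Signed
  using (_∣_; divides; _∣?_; ∣m∣n⇒∣m+n; ∣m∣n⇒∣m-n; ∣n⇒∣m*n; module ∣-Reasoning)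
open import Data.Integer.Properties as ℤP using ()
open import Data.Integer.Tactic.RingSolver using (solve-∀)
open import Data.List
  using (List; []; _∷_; _++_; foldr; tabulate; length; lookup; map; allFin; concatMap; cartesianProduct; filterᵇ)
open import Data.List.Membership.Propositional using (_∈_; _∉_)
open import Data.List.Membership.Propositional.Properties
  using (∈-lookup; ∈-allFin; ∈-cartesianProduct⁺; ∈-cartesianProduct⁻; ∈-map⁻; ∈-filter⁻)
open import Data.List.Properties using (length-++; length-map; length-tabulate)
import Data.List.Relation.Unary.All as All
open import Data.List.Relation.Unary.AllPairs using ([]; _∷_)
open import Data.List.Relation.Unary.Any as Any using (here)
open import Data.List.Relation.Unary.Any.Properties using (lookup-index)
open import Data.List.Relation.Unary.Unique.Propositional using (Unique)
open import Data.List.Relation.Unary.Unique.Propositional.Properties as Unique using (allFin⁺; cartesianProduct⁺)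
open import Data.Nat as ℕ using (ℕ; zero; suc; _∸_; _≤_; _<_; z≤n; s≤s)
open import Data.Nat.Coprimality using (Coprime; coprime-Bézout; prime⇒coprime)
open import Data.Nat.GCD using (module Bézout)
open import Data.Nat.Induction using (<-wellFounded)
open import Data.Nat.ListAction using (product)
open import Data.Nat.Primality using (Prime; prime⇒nonZero; prime⇒nonTrivial)
open import Data.Nat.Properties as ℕP using ()
open import Data.Product using (Σ; ∃-syntax; _×_; _,_; proj₁; proj₂)
open import Data.Product.Properties using (≡-dec)
open import Data.Rational as Q using (ℚ; _/_)
open import Data.Rational.Properties as QP using ()
open import Data.Rational.Unnormalised as U using (ℚᵘ; mkℚᵘ; 0ℚᵘ)
open import Data.Rational.Unnormalised.Properties as UP using ()
open import Data.Sum using (_⊎_; inj₁; inj₂; [_,_]′)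
open import Data.Unit using (⊤; tt)
open import Data.Vec.Functional using (insertAt) renaming (_++_ to _++ᵛ_)
open import Data.Vec.Functional.Properties using (insertAt-lookup; insertAt-punchIn; lookup-++ˡ; lookup-++ʳ)
open import Function using (_∘_; _$_; id)
open import Induction.WellFounded using (Acc; acc)
open import Relation.Binary.Definitions using (DecidableEquality)
open import Relation.Binary.PropositionalEquality
  using (_≡_; _≢_; refl; sym; trans; cong; cong₂; subst; subst₂; module ≡-Reasoning)
open import Relation.Nullary using (¬_; Dec; yes; no; does)
open import Relation.Nullary.Decidable using (dec-true; dec-false; decidable-stable)

open import Algebra.Properties.Semiring.Sum ℤP.+-*-semiring
  using (sum; sum-cong-≗; sum-remove; ∑-distrib-+; ∑-comm; *-distribˡ-sum; *-distribʳ-sum)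

-- Integer arithmetic is opened only inside this module, since proposition7p8 uses the _+_ and _*_ of ℚ.
module _ where

  open import Data.Integer using (_+_; _*_; -_; _-_)

  sum-zero : ∀ {n} (f : Fin n → ℤ) → (∀ i → f i ≡ 0ℤ) → sum f ≡ 0ℤ
  sum-zero {zero}  f f≡0 = refl
  sum-zero {suc n} f f≡0 = cong₂ _+_ (f≡0 F.zero) (sum-zero (f ∘ F.suc) (f≡0 ∘ F.suc))

  sum-neg : ∀ {n} (f : Fin n → ℤ) → sum (λ i → - f i) ≡ - sum f
  sum-neg {zero}  f = refl
  sum-neg {suc n} f = trans (cong (_+_ (- f F.zero)) (sum-neg (f ∘ F.suc))) (sym (ℤP.neg-distrib-+ (f F.zero) _))

  sum-↑ˡ-↑ʳ : ∀ m {n} (f : Fin (m ℕ.+ n) → ℤ) → sum f ≡ sum (λ i → f (i ↑ˡ n)) + sum (λ i → f (m ↑ʳ i))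
  sum-↑ˡ-↑ʳ zero    f = sym (ℤP.+-identityˡ _)
  sum-↑ˡ-↑ʳ (suc m) f = trans (cong (_+_ (f F.zero)) (sum-↑ˡ-↑ʳ m (f ∘ F.suc))) (sym (ℤP.+-assoc (f F.zero) _ _))

  ∣-sum : ∀ {k n} (f : Fin n → ℤ) → (∀ i → k ∣ f i) → k ∣ sum f
  ∣-sum {n = zero}  f k∣f = divides 0ℤ refl
  ∣-sum {n = suc n} f k∣f = ∣m∣n⇒∣m+n (k∣f F.zero) (∣-sum (f ∘ F.suc) (k∣f ∘ F.suc))

  ∣-sum-congruent : ∀ {k n} (f g : Fin n → ℤ) → (∀ t → k ∣ f t - g t) → k ∣ sum g → k ∣ sum f
  ∣-sum-congruent {k} f g k∣f-g k∣∑g = begin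
    k                                ∣⟨ ∣m∣n⇒∣m+n (∣-sum (λ t → f t - g t) k∣f-g) k∣∑g ⟩
    sum (λ t → f t - g t) + sum g    ≡⟨ sym (∑-distrib-+ (λ t → f t - g t) g) ⟩
    sum (λ t → f t - g t + g t)      ≡⟨ sum-cong-≗ (λ t → cancel (f t) (g t)) ⟩
    sum f                            ∎
    where
    open ∣-Reasoning
    cancel : ∀ a b → a - b + b ≡ a
    cancel = solve-∀

  ∣-difference-≡ : ∀ {k} a {b} → a ≡ b → k ∣ a - b
  ∣-difference-≡ a refl = divides 0ℤ (ℤP.+-inverseʳ a)

  ∣⇒≡0[mod] : ∀ {m a} → + m ∣ a → a ≡ 0ℤ [mod m ]
  ∣⇒≡0[mod] (divides q a≡q*m) = q , trans a≡q*m (sym (ℤP.+-identityˡ _))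

  ≡0[mod]⇒∣ : ∀ {m a} → a ≡ 0ℤ [mod m ] → + m ∣ a
  ≡0[mod]⇒∣ (q , a≡0+q*m) = divides q (trans a≡0+q*m (ℤP.+-identityˡ _))

  ≡-≡0[mod] : ∀ {m a b} → a ≡ b → b ≡ 0ℤ [mod m ] → a ≡ 0ℤ [mod m ]
  ≡-≡0[mod] refl b≡0 = b≡0

  mask : Bool → ℤ → ℤ
  mask b z = if b then z else 0ℤ

  mask-∣ : ∀ {k} b {z} → k ∣ z → k ∣ mask b z
  mask-∣ true  k∣z = k∣z
  mask-∣ false k∣z = divides 0ℤ refl

  mask-minus : ∀ b a h c → (b ≡ false → h ≡ 0ℤ) → mask b (a - h - c) ≡ mask b (a - c) - h
  mask-minus true  a h c _   = swap a h c
    where swap : ∀ a h c → a - h - c ≡ a - c - h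
          swap = solve-∀
  mask-minus false a h c h≡0 = trans (cong -_ (sym (h≡0 refl))) (sym (ℤP.+-identityˡ (- h)))

  -- Integer linear dependences

  Dependence : ∀ {m n} → (Fin n → Fin m → ℤ) → (Fin n → ℤ) → Set
  Dependence v c = ∀ j → sum (λ i → c i * v i j) ≡ 0ℤ

  NontrivialDependence : ∀ {m n} → (Fin n → Fin m → ℤ) → Set
  NontrivialDependence v = ∃[ c ] (∃[ i ] c i ≢ 0ℤ) × Dependence v c

  PrimitiveDependence : ∀ {m n} → ℕ → (Fin n → Fin m → ℤ) → Set
  PrimitiveDependence L v = ∃[ c ] (∃[ i ] ¬ (+ L ∣ c i)) × Dependence v c

  module Elimination {m n} (v : Fin (suc n) → Fin (suc m) → ℤ) (k : Fin (suc n)) where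

    pivot : ℤ
    pivot = v k F.zero

    eliminated : Fin n → Fin (suc m) → ℤ
    eliminated i j = pivot * v (punchIn k i) j - v (punchIn k i) F.zero * v k j

    lift : (Fin n → ℤ) → Fin (suc n) → ℤ
    lift c = insertAt (λ i → pivot * c i) k (- sum (λ i → v (punchIn k i) F.zero * c i))

    lift-combination : ∀ c j → sum (λ i → lift c i * v i j) ≡ sum (λ i → c i * eliminated i j)
    lift-combination c j = begin
      sum (λ i → lift c i * v i j)
        ≡⟨ sum-remove {i = k} (λ i → lift c i * v i j) ⟩
      lift c k * v k j + sum (λ i → lift c (punchIn k i) * v (punchIn k i) j)
        ≡⟨ cong₂ _+_ (cong (_* v k j) (insertAt-lookup _ k _))
                     (sum-cong-≗ (λ i → cong (_* v (punchIn k i) j) (insertAt-punchIn _ k _ i))) ⟩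
      - S * v k j + sum (λ i → pivot * c i * v (punchIn k i) j)
        ≡⟨ cong (_+ sum (λ i → pivot * c i * v (punchIn k i) j)) (sym pull-out) ⟩
      sum (λ i → - (r i * c i) * v k j) + sum (λ i → pivot * c i * v (punchIn k i) j)
        ≡⟨ sym (∑-distrib-+ (λ i → - (r i * c i) * v k j) (λ i → pivot * c i * v (punchIn k i) j)) ⟩
      sum (λ i → - (r i * c i) * v k j + pivot * c i * v (punchIn k i) j)
        ≡⟨ sum-cong-≗ (λ i → rearrange (c i) pivot (v (punchIn k i) j) (r i) (v k j)) ⟩
      sum (λ i → c i * eliminated i j) ∎
      where
      open ≡-Reasoning
      r : Fin n → ℤ
      r i = v (punchIn k i) F.zero
      S = sum (λ i → r i * c i)
      pull-out : sum (λ i → - (r i * c i) * v k j) ≡ - S * v k j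
      pull-out = trans (sym (*-distribʳ-sum (v k j) (λ i → - (r i * c i))))
                       (cong (_* v k j) (sum-neg (λ i → r i * c i)))
      rearrange : ∀ c a b d e → - (d * c) * e + a * c * b ≡ c * (a * b - d * e)
      rearrange = solve-∀

    lift-dependence : ∀ {c} → Dependence (λ i j → eliminated i (F.suc j)) c → Dependence v (lift c)
    lift-dependence {c} dep F.zero    = trans (lift-combination c F.zero) (sum-zero _ column₀-eliminated)
      where
      cancel : ∀ c a b → c * (a * b - b * a) ≡ 0ℤ
      cancel = solve-∀
      column₀-eliminated : ∀ i → c i * eliminated i F.zero ≡ 0ℤ
      column₀-eliminated i = cancel (c i) pivot (v (punchIn k i) F.zero)
    lift-dependence {c} dep (F.suc j) = trans (lift-combination c (F.suc j)) (dep j)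

    lift-nonzero : ∀ {c i} → pivot ≢ 0ℤ → c i ≢ 0ℤ → lift c (punchIn k i) ≢ 0ℤ
    lift-nonzero {c} {i} pivot≢0 c≢0 lift≡0
      with ℤP.i*j≡0⇒i≡0∨j≡0 pivot (trans (sym (insertAt-punchIn _ k _ i)) lift≡0)
    ... | inj₁ pivot≡0 = pivot≢0 pivot≡0
    ... | inj₂ c≡0     = c≢0 c≡0

  nontrivial-dependence : ∀ {m n} → m < n → (v : Fin n → Fin m → ℤ) → NontrivialDependence v
  nontrivial-dependence {zero}  {suc n} _ v = (λ _ → 1ℤ) , (F.zero , λ ()) , λ ()
  nontrivial-dependence {suc m} {suc n} (s≤s m<n) v with all? (λ k → v k F.zero ℤP.≟ 0ℤ)
  ... | yes column₀≡0 = extend (nontrivial-dependence (ℕP.m≤n⇒m≤1+n m<n) (λ i j → v i (F.suc j)))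
    where
    extend : NontrivialDependence (λ i j → v i (F.suc j)) → NontrivialDependence v
    extend (c , c≢0 , dep) = c , c≢0 , λ where
      F.zero    → sum-zero _ (λ i → trans (cong (c i *_) (column₀≡0 i)) (ℤP.*-zeroʳ (c i)))
      (F.suc j) → dep j
  ... | no column₀≢0 with ¬∀⟶∃¬ (suc n) _ (λ k → v k F.zero ℤP.≟ 0ℤ) column₀≢0
  ...   | k , pivot≢0 = lift-solution (nontrivial-dependence m<n (λ i j → eliminated i (F.suc j)))
    where
    open Elimination v k
    lift-solution : NontrivialDependence (λ i j → eliminated i (F.suc j)) → NontrivialDependence v
    lift-solution (c , (i , c≢0) , dep) = lift c , (punchIn k i , lift-nonzero pivot≢0 c≢0) , lift-dependence dep

  dependence-cancel : ∀ {m n} {v : Fin n → Fin m → ℤ} {c : Fin n → ℤ} (k : ℤ) → k ≢ 0ℤ →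
                      Dependence v (λ i → k * c i) → Dependence v c
  dependence-cancel {v = v} {c} k k≢0 dep j
    with ℤP.i*j≡0⇒i≡0∨j≡0 k (trans (*-distribˡ-sum k (λ i → c i * v i j))
                                  (trans (sum-cong-≗ (λ i → sym (ℤP.*-assoc k (c i) (v i j)))) (dep j)))
  ... | inj₁ k≡0   = ⊥-elim (k≢0 k≡0)
  ... | inj₂ sum≡0 = sum≡0

  primitive-dependence : ∀ {m n} {v : Fin n → Fin m → ℤ} (L : ℕ) → 1 < L →
                         NontrivialDependence v → PrimitiveDependence L v
  primitive-dependence {n = n} {v} L 1<L (c , (i₀ , c≢0) , dep) = reduce c c≢0 dep (<-wellFounded ∣ c i₀ ∣)
    where
    L≢0 : + L ≢ 0ℤ
    L≢0 L≡0 = ℕP.<⇒≢ (ℕP.<-trans ℕ.z<s 1<L) (sym (ℤP.+-injective L≡0))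
    reduce : ∀ c → c i₀ ≢ 0ℤ → Dependence v c → Acc _<_ ∣ c i₀ ∣ → PrimitiveDependence L v
    reduce c c≢0 dep (acc smaller) with all? (λ i → + L ∣? c i)
    ... | no  ¬all-divisible = c , ¬∀⟶∃¬ n _ (λ i → + L ∣? c i) ¬all-divisible , dep
    ... | yes all-divisible  = reduce c′ c′≢0 dep′ (smaller shrinks)
      where
      c′ : Fin n → ℤ
      c′ i = _∣_.quotient (all-divisible i)
      c≡L*c′ : ∀ i → c i ≡ + L * c′ i
      c≡L*c′ i = trans (_∣_.equality (all-divisible i)) (ℤP.*-comm (c′ i) (+ L))
      c′≢0 : c′ i₀ ≢ 0ℤ
      c′≢0 c′≡0 = c≢0 (trans (c≡L*c′ i₀) (trans (cong (+ L *_) c′≡0) (ℤP.*-zeroʳ (+ L))))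
      dep′ : Dependence v c′
      dep′ = dependence-cancel {v = v} {c′} (+ L) L≢0
               (λ j → trans (sum-cong-≗ (λ i → cong (_* v i j) (sym (c≡L*c′ i)))) (dep j))
      shrinks : ∣ c′ i₀ ∣ < ∣ c i₀ ∣
      shrinks = ℕP.<-≤-trans (ℕP.m<m*n ∣ c′ i₀ ∣ L {{ℕ.≢-nonZero (c′≢0 ∘ ℤP.∣i∣≡0⇒i≡0)}} 1<L)
                             (ℕP.≤-reflexive (trans (ℕP.*-comm _ L)
                               (trans (sym (ℤP.abs-* (+ L) (c′ i₀))) (cong ∣_∣ (sym (c≡L*c′ i₀))))))

  -- Units of ℤ_ℓ

  coprime-bézout : ∀ {p r} → Coprime p r → ∃[ α ] ∃[ β ] α * + r ≡ 1ℤ - β * + p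
  coprime-bézout {p} {r} p⊥r with coprime-Bézout p⊥r
  ... | Bézout.+- x y eq = - + y , + x , (begin
    - + y * + r            ≡⟨ cancel (+ y) (+ r) ⟩
    1ℤ - (1ℤ + + y * + r)  ≡⟨ cong (λ z → 1ℤ - z) (cast eq) ⟩
    1ℤ - + x * + p         ∎)
    where
    open ≡-Reasoning
    cancel : ∀ y r → - y * r ≡ 1ℤ - (1ℤ + y * r)
    cancel = solve-∀
    cast : 1 ℕ.+ y ℕ.* r ≡ x ℕ.* p → 1ℤ + + y * + r ≡ + x * + p
    cast e = trans (cong (_+_ 1ℤ) (sym (ℤP.pos-* y r))) (trans (cong +_ e) (ℤP.pos-* x p))
  ... | Bézout.-+ x y eq = + y , - + x , (begin
    + y * + r             ≡⟨ sym (cast eq) ⟩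
    1ℤ + + x * + p        ≡⟨ negate (+ x) (+ p) ⟩
    1ℤ - - + x * + p      ∎)
    where
    open ≡-Reasoning
    negate : ∀ x p → 1ℤ + x * p ≡ 1ℤ - - x * p
    negate = solve-∀
    cast : 1 ℕ.+ x ℕ.* p ≡ y ℕ.* r → 1ℤ + + x * + p ≡ + y * + r
    cast e = trans (cong (_+_ 1ℤ) (sym (ℤP.pos-* x p))) (trans (cong +_ e) (ℤP.pos-* y r))

  prime-bézout : ∀ {p} → Prime p → ∀ γ → ¬ (+ p ∣ γ) → ∃[ α ] ∃[ β ] α * γ ≡ 1ℤ - β * + p
  prime-bézout {p} p-prime γ p∤γ = bézout (γ %ℕ p) (n%ℕd<d γ p) (a≡a%ℕn+[a/ℕn]*n γ p)
    where
    instance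
      p≢0 : ℕ.NonZero p
      p≢0 = prime⇒nonZero p-prime
    t = γ /ℕ p
    bézout : ∀ r → r < p → γ ≡ + r + t * + p → ∃[ α ] ∃[ β ] α * γ ≡ 1ℤ - β * + p
    bézout zero    _   γ≡t*p = ⊥-elim (p∤γ (divides t (trans γ≡t*p (ℤP.+-identityˡ _))))
    bézout (suc r) r<p γ≡    with coprime-bézout (prime⇒coprime p-prime r<p)
    ... | α , β , αr≡ = α , β - α * t , (begin
      α * γ                          ≡⟨ cong (α *_) γ≡ ⟩
      α * (+ suc r + t * + p)        ≡⟨ ℤP.*-distribˡ-+ α (+ suc r) (t * + p) ⟩
      α * + suc r + α * (t * + p)    ≡⟨ cong (_+ α * (t * + p)) αr≡ ⟩
      1ℤ - β * + p + α * (t * + p)   ≡⟨ regroup β α t (+ p) ⟩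
      1ℤ - (β - α * t) * + p         ∎)
      where
      open ≡-Reasoning
      regroup : ∀ β α t p → 1ℤ - β * p + α * (t * p) ≡ 1ℤ - (β - α * t) * p
      regroup = solve-∀

  module _ {ℓ : ℕ} where

    fromℤ : ℤ → ℤ[ ℓ ]
    fromℤ z = mkℤℓ (λ _ → z) λ n →
      0ℤ , sym (trans (cong (_+_ z) (ℤP.*-zeroˡ (+ (ℓ ℕ.^ n)))) (ℤP.+-identityʳ z))

    _*ℓ_ : ℤ[ ℓ ] → ℤ[ ℓ ] → ℤ[ ℓ ]
    u *ℓ v = mkℤℓ (λ n → seq u n * seq v n) compat-*
      where
      compat-* : ∀ n → (seq u (suc n) * seq v (suc n)) ≡ (seq u n * seq v n) [mod ℓ ℕ.^ n ]
      compat-* n with compat u n | compat v n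
      ... | q , u≡ | r , v≡ = q * seq v n + seq u n * r + q * r * + (ℓ ℕ.^ n) ,
                              trans (cong₂ _*_ u≡ v≡) (expand (seq u n) (seq v n) q r (+ (ℓ ℕ.^ n)))
        where expand : ∀ a b q r m → (a + q * m) * (b + r * m) ≡ a * b + (q * b + a * r + q * r * m) * m
              expand = solve-∀

    -- The inverse of γ is α (1 + βℓ + (βℓ)² + …), where αγ = 1 − βℓ.
    unit-inverse : Prime ℓ → ∀ γ → ¬ (+ ℓ ∣ γ) →
                   Σ ℤ[ ℓ ] λ t → ∀ n → + (ℓ ℕ.^ n) ∣ γ * seq t n - 1ℤ
    unit-inverse ℓ-prime γ ℓ∤γ with prime-bézout ℓ-prime γ ℓ∤γ
    ... | α , β , αγ≡ = mkℤℓ (λ n → α * geometric n) compat-inverse , inverse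
      where
      geometric : ℕ → ℤ
      geometric zero    = 0ℤ
      geometric (suc n) = geometric n + β ℤ.^ n * + (ℓ ℕ.^ n)
      compat-inverse : ∀ n → (α * geometric (suc n)) ≡ (α * geometric n) [mod ℓ ℕ.^ n ]
      compat-inverse n = α * β ℤ.^ n , distrib α (geometric n) (β ℤ.^ n) (+ (ℓ ℕ.^ n))
        where distrib : ∀ a g b m → a * (g + b * m) ≡ a * g + a * b * m
              distrib = solve-∀
      telescope : ∀ n → (1ℤ - β * + ℓ) * geometric n ≡ 1ℤ - β ℤ.^ n * + (ℓ ℕ.^ n)
      telescope zero    = ℤP.*-zeroʳ (1ℤ - β * + ℓ)
      telescope (suc n) = begin
        (1ℤ - β * + ℓ) * (geometric n + βⁿ * + ℓⁿ)
          ≡⟨ ℤP.*-distribˡ-+ (1ℤ - β * + ℓ) (geometric n) (βⁿ * + ℓⁿ) ⟩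
        (1ℤ - β * + ℓ) * geometric n + (1ℤ - β * + ℓ) * (βⁿ * + ℓⁿ)
          ≡⟨ cong (_+ (1ℤ - β * + ℓ) * (βⁿ * + ℓⁿ)) (telescope n) ⟩
        1ℤ - βⁿ * + ℓⁿ + (1ℤ - β * + ℓ) * (βⁿ * + ℓⁿ)
          ≡⟨ collapse β βⁿ (+ ℓ) (+ ℓⁿ) ⟩
        1ℤ - β * βⁿ * (+ ℓ * + ℓⁿ)
          ≡⟨ cong (λ z → 1ℤ - β * βⁿ * z) (sym (ℤP.pos-* ℓ ℓⁿ)) ⟩
        1ℤ - β ℤ.^ suc n * + (ℓ ℕ.^ suc n) ∎
        where
        open ≡-Reasoning
        βⁿ = β ℤ.^ n
        ℓⁿ = ℓ ℕ.^ n
        collapse : ∀ β b l m → 1ℤ - b * m + (1ℤ - β * l) * (b * m) ≡ 1ℤ - β * b * (l * m)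
        collapse = solve-∀
      inverse : ∀ n → + (ℓ ℕ.^ n) ∣ γ * (α * geometric n) - 1ℤ
      inverse n = divides (- β ℤ.^ n) (begin
        γ * (α * geometric n) - 1ℤ          ≡⟨ cong (λ z → z - 1ℤ) (reassoc γ α (geometric n)) ⟩
        α * γ * geometric n - 1ℤ            ≡⟨ cong (λ z → z * geometric n - 1ℤ) αγ≡ ⟩
        (1ℤ - β * + ℓ) * geometric n - 1ℤ   ≡⟨ cong (λ z → z - 1ℤ) (telescope n) ⟩
        1ℤ - β ℤ.^ n * + (ℓ ℕ.^ n) - 1ℤ     ≡⟨ cancel (β ℤ.^ n) (+ (ℓ ℕ.^ n)) ⟩
        - β ℤ.^ n * + (ℓ ℕ.^ n)             ∎)
        where
        open ≡-Reasoning
        reassoc : ∀ γ α g → γ * (α * g) ≡ α * γ * g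
        reassoc = solve-∀
        cancel : ∀ b m → 1ℤ - b * m - 1ℤ ≡ - b * m
        cancel = solve-∀

  module _ {ℓ k₀ : ℕ} where

    coord : Rξ ℓ k₀ → Fin (deg ℓ k₀) → ℕ → ℤ
    coord r i n = seq (coeff r i) n

    _·R_ : ℤ[ ℓ ] → Rξ ℓ k₀ → Rξ ℓ k₀
    u ·R r = mkR (λ i → u *ℓ coeff r i)

    ≡-≈0R : ∀ {r r′ : Rξ ℓ k₀} → r ≡ r′ → r′ ≈R 0R → r ≈R 0R
    ≡-≈0R refl r′≈0 = r′≈0

  module _ {ℓ k₀ : ℕ} {ns : List ℕ} where

    coord-lineSum : ∀ (Y : Subset ns) (a : Pt ns → Rξ ℓ k₀) s x₀ i n →
      coord (lineSum Y a s x₀) i n ≡ sum (λ t → mask (Y (update ns x₀ s t)) (coord (a (update ns x₀ s t)) i n))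
    coord-lineSum Y a s x₀ i n = coord-foldr id
      where
      summand : Fin (Size ns s) → Rξ ℓ k₀
      summand t = if Y (update ns x₀ s t) then a (update ns x₀ s t) else 0R
      coord-summand : ∀ t → coord (summand t) i n ≡ mask (Y (update ns x₀ s t)) (coord (a (update ns x₀ s t)) i n)
      coord-summand t with Y (update ns x₀ s t)
      ... | true  = refl
      ... | false = refl
      coord-foldr : ∀ {m} (g : Fin m → Fin (Size ns s)) →
        coord (foldr (λ t acc → summand t +R acc) 0R (tabulate g)) i n
          ≡ sum (λ t → mask (Y (update ns x₀ s (g t))) (coord (a (update ns x₀ s (g t))) i n))
      coord-foldr {zero}  g = refl
      coord-foldr {suc m} g = cong₂ _+_ (coord-summand (g F.zero)) (coord-foldr (g ∘ F.suc))

    lineSum-≈0R-congruent : ∀ {W W′ : Subset ns} {f g : Pt ns → Rξ ℓ k₀} →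
      (∀ i n x → + (ℓ ℕ.^ n) ∣ mask (W′ x) (coord (f x) i n) - mask (W x) (coord (g x) i n)) →
      ∀ s x₀ → lineSum W g s x₀ ≈R 0R → lineSum W′ f s x₀ ≈R 0R
    lineSum-≈0R-congruent {W} {W′} {f} {g} f≡g s x₀ g-line i n = ∣⇒≡0[mod] $ begin
      + (ℓ ℕ.^ n)
        ∣⟨ ∣-sum-congruent (λ t → mask (W′ (u t)) (coord (f (u t)) i n))
                           (λ t → mask (W (u t)) (coord (g (u t)) i n))
                           (f≡g i n ∘ u)
                           (subst (+ (ℓ ℕ.^ n) ∣_) (coord-lineSum W g s x₀ i n) (≡0[mod]⇒∣ (g-line i n))) ⟩
      sum (λ t → mask (W′ (u t)) (coord (f (u t)) i n))
        ≡⟨ sym (coord-lineSum W′ f s x₀ i n) ⟩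
      coord (lineSum W′ f s x₀) i n ∎
      where
      open ∣-Reasoning
      u = update ns x₀ s

    lineSum-subtract-zeroSum : ∀ (Z : Subset ns) (a h b : Pt ns → Rξ ℓ k₀) s x₀ i n →
      (∀ x → Z x ≡ false → coord (h x) i n ≡ 0ℤ) → sum (λ t → coord (h (update ns x₀ s t)) i n) ≡ 0ℤ →
      coord (lineSum Z (λ x → (a x -R h x) -R b x) s x₀) i n ≡ coord (lineSum Z (λ x → a x -R b x) s x₀) i n
    lineSum-subtract-zeroSum Z a h b s x₀ i n h-off h-line = begin
      coord (lineSum Z (λ x → (a x -R h x) -R b x) s x₀) i n
        ≡⟨ coord-lineSum Z (λ x → (a x -R h x) -R b x) s x₀ i n ⟩
      sum (λ t → mask (Z (u t)) (coord ((a (u t) -R h (u t)) -R b (u t)) i n))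
        ≡⟨ sum-cong-≗ (λ t → mask-minus (Z (u t)) (coord (a (u t)) i n) (coord (h (u t)) i n) (coord (b (u t)) i n)
                                        (h-off (u t))) ⟩
      sum (λ t → mask (Z (u t)) (coord (a (u t) -R b (u t)) i n) - coord (h (u t)) i n)
        ≡⟨ ∑-distrib-+ (λ t → mask (Z (u t)) (coord (a (u t) -R b (u t)) i n)) (λ t → - coord (h (u t)) i n) ⟩
      sum (λ t → mask (Z (u t)) (coord (a (u t) -R b (u t)) i n)) + sum (λ t → - coord (h (u t)) i n)
        ≡⟨ cong₂ _+_ (sym (coord-lineSum Z (λ x → a x -R b x) s x₀ i n))
                     (trans (sum-neg (λ t → coord (h (u t)) i n)) (cong -_ h-line)) ⟩
      coord (lineSum Z (λ x → a x -R b x) s x₀) i n + 0ℤ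
        ≡⟨ ℤP.+-identityʳ _ ⟩
      coord (lineSum Z (λ x → a x -R b x) s x₀) i n ∎
      where
      open ≡-Reasoning
      u = update ns x₀ s

  _≟Pt_ : ∀ {ns} → DecidableEquality (Pt ns)
  _≟Pt_ {[]}     _ _ = yes refl
  _≟Pt_ {n ∷ ns} = ≡-dec F._≟_ _≟Pt_

  module _ {ns : List ℕ} {A : Set} where

    _[_≔_] : (Pt ns → A) → Pt ns → A → Pt ns → A
    (f [ y ≔ v ]) x = if does (x ≟Pt y) then v else f x

    override-≡ : ∀ f y (v : A) → (f [ y ≔ v ]) y ≡ v
    override-≡ f y v = cong (λ b → if b then v else f y) (dec-true (y ≟Pt y) refl)

    override-≢ : ∀ f {x y} (v : A) → x ≢ y → (f [ y ≔ v ]) x ≡ f x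
    override-≢ f {x} {y} v x≢y = cong (λ b → if b then v else f x) (dec-false (x ≟Pt y) x≢y)

  override-cases : ∀ {ns} {P : Pt ns → Set} y → P y → (∀ x → x ≢ y → P x) → ∀ x → P x
  override-cases y Py P≢ x with x ≟Pt y
  ... | yes refl = Py
  ... | no  x≢y  = P≢ x x≢y

  module _ {ns : List ℕ} where

    ZeroSum : (Pt ns → ℤ) → Set
    ZeroSum G = ∀ s x₀ → sum (λ t → G (update ns x₀ s t)) ≡ 0ℤ

    SupportedOn : Subset ns → (Pt ns → ℤ) → Set
    SupportedOn Y G = ∀ x → Y x ≡ false → G x ≡ 0ℤ

    ∉⊎∈ : ∀ (Y : Subset ns) x → Y x ≡ false ⊎ T (Y x)
    ∉⊎∈ Y x with Y x
    ... | false = inj₁ refl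
    ... | true  = inj₂ _

    ∈⇒≢ : ∀ {S : Subset ns} {x y} → T (S y) → S x ≡ false → x ≢ y
    ∈⇒≢ Sy Sx≡false refl = subst T Sx≡false Sy

    ⊆-∉ : ∀ {Y Z : Subset ns} → Y ⊆ Z → ∀ x → Z x ≡ false → Y x ≡ false
    ⊆-∉ {Y} Y⊆Z x x∉Z with ∉⊎∈ Y x
    ... | inj₁ x∉Y = x∉Y
    ... | inj₂ x∈Y = ⊥-elim (subst T x∉Z (Y⊆Z x x∈Y))

    override-false-⊆ : ∀ (Y : Subset ns) y → (Y [ y ≔ false ]) ⊆ Y
    override-false-⊆ Y y x x∈Y′ with x ≟Pt y
    ... | no _ = x∈Y′

    ⊆-override-true : ∀ (W : Subset ns) y → W ⊆ (W [ y ≔ true ])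
    ⊆-override-true W y x x∈W with x ≟Pt y
    ... | yes _ = _
    ... | no  _ = x∈W

    override-⊆-override : ∀ {Y W : Subset ns} y → (Y [ y ≔ false ]) ⊆ W → Y ⊆ (W [ y ≔ true ])
    override-⊆-override {Y} y Y′⊆W x x∈Y with x ≟Pt y
    ... | yes _   = _
    ... | no  x≢y = Y′⊆W x (subst T (sym (override-≢ Y false x≢y)) x∈Y)

  -- Removing a point from a generating set

  module _ {ℓ k₀ : ℕ} {ns : List ℕ} where

    Preimage : Subset ns → Subset ns → (Pt ns → Rξ ℓ k₀) → Set
    Preimage Y W b = Σ (Pt ns → Rξ ℓ k₀) λ a → FunOn Y a × InZs W (λ x → a x -R b x)

    override-0R-on : ∀ {W : Subset ns} {y} {b : Pt ns → Rξ ℓ k₀} →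
                     FunOn (W [ y ≔ true ]) b → FunOn W (b [ y ≔ 0R ])
    override-0R-on {W} {y} b-on x x∉W with x ≟Pt y
    ... | yes refl = λ i n → 0ℤ , refl
    ... | no  x≢y  = b-on x (trans (override-≢ W true x≢y) x∉W)

    preimage-insert : ∀ {Y W : Subset ns} {y} {b : Pt ns → Rξ ℓ k₀} → T (Y y) →
                      Preimage (Y [ y ≔ false ]) W (b [ y ≔ 0R ]) → Preimage Y (W [ y ≔ true ]) b
    preimage-insert {Y} {W} {y} {b} y∈Y (a₁ , a₁-on , a₁-b₁-on , a₁-b₁-lines) = a , a-on , a-b-on , a-b-lines
      where
      b₁ a : Pt ns → Rξ ℓ k₀
      b₁ = b [ y ≔ 0R ]
      a = a₁ [ y ≔ b y ]
      a-on : FunOn Y a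
      a-on x x∉Y = ≡-≈0R (override-≢ a₁ (b y) x≢y) (a₁-on x (trans (override-≢ Y false x≢y) x∉Y))
        where x≢y = ∈⇒≢ y∈Y x∉Y
      a-b-on : FunOn (W [ y ≔ true ]) (λ x → a x -R b x)
      a-b-on x x∉W′ = ≡-≈0R (cong₂ _-R_ (override-≢ a₁ (b y) x≢y) (sym (override-≢ b 0R x≢y)))
                            (a₁-b₁-on x (trans (sym (override-≢ W true x≢y)) x∉W′))
        where x≢y = ∈⇒≢ (subst T (sym (override-≡ W y true)) _) x∉W′
      a-b-lines : ∀ s x₀ → lineSum (W [ y ≔ true ]) (λ x → a x -R b x) s x₀ ≈R 0R
      a-b-lines s x₀ = lineSum-≈0R-congruent {W = W} {W [ y ≔ true ]} {λ x → a x -R b x} {λ x → a₁ x -R b₁ x}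
                                             termwise s x₀ (a₁-b₁-lines s x₀)
        where
        termwise : ∀ i n x → + (ℓ ℕ.^ n) ∣ mask ((W [ y ≔ true ]) x) (coord (a x -R b x) i n)
                                           - mask (W x) (coord (a₁ x -R b₁ x) i n)
        termwise i n = override-cases y (∣m∣n⇒∣m-n (mask-∣ ((W [ y ≔ true ]) y) a-b-y) (mask-∣ (W y) a₁-b₁-y))
          λ x x≢y → ∣-difference-≡ _ (cong₂ mask (override-≢ W true x≢y)
                                              (cong₂ (λ r r′ → coord (r -R r′) i n) (override-≢ a₁ (b y) x≢y)
                                                     (sym (override-≢ b 0R x≢y))))
          where
          a-b-y : + (ℓ ℕ.^ n) ∣ coord (a y -R b y) i n
          a-b-y = subst (λ r → + (ℓ ℕ.^ n) ∣ coord (r -R b y) i n) (sym (override-≡ a₁ y (b y)))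
                        (∣-difference-≡ (coord (b y) i n) refl)
          a₁y∣ : + (ℓ ℕ.^ n) ∣ coord (a₁ y) i n
          a₁y∣ = ≡0[mod]⇒∣ (a₁-on y (override-≡ Y y false) i n)
          a₁-b₁-y : + (ℓ ℕ.^ n) ∣ coord (a₁ y -R b₁ y) i n
          a₁-b₁-y = subst (λ r → + (ℓ ℕ.^ n) ∣ coord (a₁ y -R r) i n) (sym (override-≡ b y 0R))
                          (subst (+ (ℓ ℕ.^ n) ∣_) (sym (ℤP.+-identityʳ (coord (a₁ y) i n))) a₁y∣)

    quotSurj-insert : ∀ {Y W : Subset ns} {y} → T (Y y) →
                      QuotSurj {ℓ} {k₀} (Y [ y ≔ false ]) W → QuotSurj {ℓ} {k₀} Y (W [ y ≔ true ])
    quotSurj-insert {y = y} y∈Y surj b b-on = preimage-insert y∈Y (surj (b [ y ≔ 0R ]) (override-0R-on b-on))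

    -- The correction h = G · G(y)⁻¹ · a(y) agrees with a at y, vanishes off Y and, as G is zero-sum,
    -- has zero line sums.
    preimage-remove : Prime ℓ → ∀ {Y Z : Subset ns} {G y} {b : Pt ns → Rξ ℓ k₀} →
                      ZeroSum G → SupportedOn Y G → ¬ (+ ℓ ∣ G y) → Y ⊆ Z → Preimage Y Z b → Preimage (Y [ y ≔ false ]) Z b
    preimage-remove ℓ-prime {Y} {Z} {G} {y} {b} G-zero-sum G-on ℓ∤Gy Y⊆Z (a , a-on , a-b-on , a-b-lines) =
      a′ , a′-on , a′-b-on , a′-b-lines
      where
      inv = proj₁ (unit-inverse ℓ-prime (G y) ℓ∤Gy)
      Gy*inv≡1 = proj₂ (unit-inverse ℓ-prime (G y) ℓ∤Gy)
      h a′ : Pt ns → Rξ ℓ k₀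
      h x = (fromℤ (G x) *ℓ inv) ·R a y
      a′ x = a x -R h x
      h-off : ∀ x → Y x ≡ false → ∀ i n → coord (h x) i n ≡ 0ℤ
      h-off x x∉Y i n = cong (λ g → g * seq inv n * coord (a y) i n) (G-on x x∉Y)
      a′-off : ∀ x → Y x ≡ false → ∀ i n → coord (a′ x) i n ≡ coord (a x) i n
      a′-off x x∉Y i n = trans (cong (λ z → coord (a x) i n - z) (h-off x x∉Y i n)) (ℤP.+-identityʳ _)
      a′-on : FunOn (Y [ y ≔ false ]) a′
      a′-on x x∉Y′ with x ≟Pt y
      ... | no  _    = λ i n → ≡-≡0[mod] (a′-off x x∉Y′ i n) (a-on x x∉Y′ i n)
      ... | yes refl = λ i n → ∣⇒≡0[mod] (begin
        + (ℓ ℕ.^ n)                                          ∣⟨ ∣n⇒∣m*n (- coord (a y) i n) (Gy*inv≡1 n) ⟩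
        - coord (a y) i n * (G y * seq inv n - 1ℤ)           ≡⟨ factor (coord (a y) i n) (G y * seq inv n) ⟩
        coord (a y) i n - G y * seq inv n * coord (a y) i n  ∎)
        where
        open ∣-Reasoning
        factor : ∀ a g → - a * (g - 1ℤ) ≡ a - g * a
        factor = solve-∀
      a′-b-on : FunOn Z (λ x → a′ x -R b x)
      a′-b-on x x∉Z i n = ≡-≡0[mod] (cong (λ z → z - coord (b x) i n) (a′-off x (⊆-∉ Y⊆Z x x∉Z) i n))
                                    (a-b-on x x∉Z i n)
      a′-b-lines : ∀ s x₀ → lineSum Z (λ x → a′ x -R b x) s x₀ ≈R 0R
      a′-b-lines s x₀ i n =
        ≡-≡0[mod] (lineSum-subtract-zeroSum Z a h b s x₀ i n (λ x x∉Z → h-off x (⊆-∉ Y⊆Z x x∉Z) i n) h-line)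
                  (a-b-lines s x₀ i n)
        where
        open ≡-Reasoning
        u = update ns x₀ s
        A = coord (a y) i n
        h-line : sum (λ t → coord (h (u t)) i n) ≡ 0ℤ
        h-line = begin
          sum (λ t → G (u t) * seq inv n * A)   ≡⟨ sym (*-distribʳ-sum A (λ t → G (u t) * seq inv n)) ⟩
          sum (λ t → G (u t) * seq inv n) * A   ≡⟨ cong (_* A) (sym (*-distribʳ-sum (seq inv n) (G ∘ u))) ⟩
          sum (G ∘ u) * seq inv n * A           ≡⟨ cong (λ z → z * seq inv n * A) (G-zero-sum s x₀) ⟩
          0ℤ                                    ∎

    closure-remove : Prime ℓ → ∀ {Y Z : Subset ns} {G y} →
                     ZeroSum G → SupportedOn Y G → T (Y y) → ¬ (+ ℓ ∣ G y) →
                     IsClosure {ℓ} {k₀} Y Z → IsClosure {ℓ} {k₀} (Y [ y ≔ false ]) Z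
    closure-remove ℓ-prime {Y} {Z} {G} {y} G-zero-sum G-on y∈Y ℓ∤Gy (Y⊆Z , surj , maximal) =
      (λ x → Y⊆Z x ∘ override-false-⊆ Y y x) ,
      (λ b b-on → preimage-remove ℓ-prime {b = b} G-zero-sum G-on ℓ∤Gy Y⊆Z (surj b b-on)) ,
      λ W Y′⊆W surj′ x x∈W → maximal (W [ y ≔ true ]) (override-⊆-override y Y′⊆W) (quotSurj-insert y∈Y surj′)
                                     x (⊆-override-true W y x x∈W)

    basis-zeroSum-divisible : Prime ℓ → ∀ {Y Z : Subset ns} {G} → IsBasis {ℓ} {k₀} Y Z →
                              ZeroSum G → SupportedOn Y G → ∀ y → + ℓ ∣ G y
    basis-zeroSum-divisible ℓ-prime {Y} {G = G} (_ , Y-closure , Y-minimal) G-zero-sum G-on y =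
      decidable-stable (+ ℓ ∣? G y) ([ (λ y∉Y ℓ∤Gy → ℓ∤Gy (off-Y y∉Y)) , on-Y ]′ (∉⊎∈ Y y))
      where
      off-Y : Y y ≡ false → + ℓ ∣ G y
      off-Y y∉Y = subst (+ ℓ ∣_) (sym (G-on y y∉Y)) (divides 0ℤ refl)
      on-Y : T (Y y) → ¬ ¬ (+ ℓ ∣ G y)
      on-Y y∈Y ℓ∤Gy = subst T (override-≡ Y y false)
        (Y-minimal (Y [ y ≔ false ]) (override-false-⊆ Y y)
                   (closure-remove ℓ-prime G-zero-sum G-on y∈Y ℓ∤Gy Y-closure) y y∈Y)

  -- Kronecker deltas and the functions E q

  module Kronecker {A : Set} (_≟_ : DecidableEquality A) where

    δ : A → A → ℤ
    δ a b = if does (a ≟ b) then 1ℤ else 0ℤ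

    δ-refl : ∀ a → δ a a ≡ 1ℤ
    δ-refl a = cong (λ b → if b then 1ℤ else 0ℤ) (dec-true (a ≟ a) refl)

    δ-≢ : ∀ {a b} → a ≢ b → δ a b ≡ 0ℤ
    δ-≢ {a} {b} a≢b = cong (λ b → if b then 1ℤ else 0ℤ) (dec-false (a ≟ b) a≢b)

    sum-δ-∉ : ∀ (xs : List A) (d : Fin (length xs) → ℤ) {x} → x ∉ xs → sum (λ i → d i * δ (lookup xs i) x) ≡ 0ℤ
    sum-δ-∉ xs d x∉xs = sum-zero _ (λ i → trans (cong (d i *_) (δ-≢ (λ eq → x∉xs (subst (_∈ xs) eq (∈-lookup i)))))
                                              (ℤP.*-zeroʳ (d i)))

    sum-δ-lookup : ∀ {xs : List A} → Unique xs → ∀ (d : Fin (length xs) → ℤ) k →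
                   sum (λ i → d i * δ (lookup xs i) (lookup xs k)) ≡ d k
    sum-δ-lookup {x ∷ xs} (x≢xs ∷ _) d F.zero = begin
      d F.zero * δ x x + sum (λ i → d (F.suc i) * δ (lookup xs i) x)
        ≡⟨ cong₂ _+_ (cong (d F.zero *_) (δ-refl x)) (sum-δ-∉ xs (d ∘ F.suc) (λ x∈xs → All.lookup x≢xs x∈xs refl)) ⟩
      d F.zero * 1ℤ + 0ℤ
        ≡⟨ trans (ℤP.+-identityʳ _) (ℤP.*-identityʳ (d F.zero)) ⟩
      d F.zero ∎
      where open ≡-Reasoning
    sum-δ-lookup {x ∷ xs} (x≢xs ∷ xs-unique) d (F.suc k) = begin
      d F.zero * δ x (lookup xs k) + sum (λ i → d (F.suc i) * δ (lookup xs i) (lookup xs k))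
        ≡⟨ cong₂ _+_ (cong (d F.zero *_) (δ-≢ (All.lookup x≢xs (∈-lookup k)))) (sum-δ-lookup xs-unique (d ∘ F.suc) k) ⟩
      d F.zero * 0ℤ + d (F.suc k)
        ≡⟨ trans (cong (_+ d (F.suc k)) (ℤP.*-zeroʳ (d F.zero))) (ℤP.+-identityˡ (d (F.suc k))) ⟩
      d (F.suc k) ∎
      where open ≡-Reasoning

  δᶠ : ∀ {n} → Fin n → Fin n → ℤ
  δᶠ = Kronecker.δ F._≟_

  sum-δᶠ : ∀ {n} (a : Fin n) → sum (δᶠ a) ≡ 1ℤ
  sum-δᶠ {suc n} a = begin
    sum (δᶠ a)                        ≡⟨ sum-remove {i = a} (δᶠ a) ⟩
    δᶠ a a + sum (δᶠ a ∘ punchIn a)   ≡⟨ cong₂ _+_ (Kronecker.δ-refl F._≟_ a)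
                                                   (sum-zero _ (λ t → Kronecker.δ-≢ F._≟_ (punchInᵢ≢i a t ∘ sym))) ⟩
    1ℤ                                ∎
    where open ≡-Reasoning

  δ : ∀ ns → Pt ns → Pt ns → ℤ
  δ ns = Kronecker.δ (_≟Pt_ {ns})

  δ-∷ : ∀ n ns (q : Fin (suc n)) qs x xs → δ (n ∷ ns) (q , qs) (x , xs) ≡ δᶠ q x * δ ns qs xs
  δ-∷ n ns q qs x xs = by-cases (q F.≟ x) (qs ≟Pt xs)
    where
    module Kᶠ = Kronecker (F._≟_ {suc n})
    module K = Kronecker (_≟Pt_ {ns})
    module K∷ = Kronecker (_≟Pt_ {n ∷ ns})
    by-cases : ∀ {q x qs xs} → Dec (q ≡ x) → Dec (qs ≡ xs) → δ (n ∷ ns) (q , qs) (x , xs) ≡ δᶠ q x * δ ns qs xs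
    by-cases {q} {qs = qs} (yes refl) (yes refl) =
      trans (K∷.δ-refl (q , qs)) (sym (cong₂ _*_ (Kᶠ.δ-refl q) (K.δ-refl qs)))
    by-cases {q} {x} {qs} {xs} (no q≢x) _ =
      trans (K∷.δ-≢ {q , qs} {x , xs} (q≢x ∘ cong proj₁)) (sym (cong (_* δ ns qs xs) (Kᶠ.δ-≢ q≢x)))
    by-cases {q} {qs = qs} {xs} (yes refl) (no qs≢xs) =
      trans (K∷.δ-≢ {q , qs} {q , xs} (qs≢xs ∘ cong proj₂))
            (sym (trans (cong (δᶠ q q *_) (K.δ-≢ qs≢xs)) (ℤP.*-zeroʳ (δᶠ q q))))

  E : ∀ ns → Pt ns → Pt ns → ℤ
  E []       _        _        = 1ℤ
  E (n ∷ ns) (q , qs) (x , xs) = (δᶠ q x - δᶠ F.zero x) * E ns qs xs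

  E-zeroSum : ∀ ns q → ZeroSum (E ns q)
  E-zeroSum (n ∷ ns) (q , qs) F.zero (x , xs) = begin
    sum (λ t → (δᶠ q t - δᶠ 0ᶠ t) * E ns qs xs)
      ≡⟨ sym (*-distribʳ-sum (E ns qs xs) (λ t → δᶠ q t - δᶠ 0ᶠ t)) ⟩
    sum (λ t → δᶠ q t - δᶠ 0ᶠ t) * E ns qs xs
      ≡⟨ cong (_* E ns qs xs) (∑-distrib-+ (δᶠ q) (λ t → - δᶠ 0ᶠ t)) ⟩
    (sum (δᶠ q) + sum (λ t → - δᶠ 0ᶠ t)) * E ns qs xs
      ≡⟨ cong (λ z → (sum (δᶠ q) + z) * E ns qs xs) (sum-neg (δᶠ 0ᶠ)) ⟩
    (sum (δᶠ q) - sum (δᶠ 0ᶠ)) * E ns qs xs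
      ≡⟨ cong₂ (λ z w → (z - w) * E ns qs xs) (sum-δᶠ q) (sum-δᶠ 0ᶠ) ⟩
    0ℤ ∎
    where
    open ≡-Reasoning
    0ᶠ : Fin (suc n)
    0ᶠ = F.zero
  E-zeroSum (n ∷ ns) (q , qs) (F.suc s) (x , xs) =
    trans (sym (*-distribˡ-sum c (λ t → E ns qs (update ns xs s t))))
          (trans (cong (c *_) (E-zeroSum ns qs s xs)) (ℤP.*-zeroʳ c))
    where c = δᶠ q x - δᶠ F.zero x

  combination-zeroSum : ∀ ns (qs : List (Pt ns)) (c : Fin (length qs) → ℤ) →
                        ZeroSum {ns} (λ x → sum (λ i → c i * E ns (lookup qs i) x))
  combination-zeroSum ns qs c s x₀ = begin
    sum (λ t → sum (λ i → c i * E ns (lookup qs i) (update ns x₀ s t)))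
      ≡⟨ ∑-comm (λ t i → c i * E ns (lookup qs i) (update ns x₀ s t)) ⟩
    sum (λ i → sum (λ t → c i * E ns (lookup qs i) (update ns x₀ s t)))
      ≡⟨ sum-zero _ line-zero ⟩
    0ℤ ∎
    where
    open ≡-Reasoning
    line-zero : ∀ i → sum (λ t → c i * E ns (lookup qs i) (update ns x₀ s t)) ≡ 0ℤ
    line-zero i = trans (sym (*-distribˡ-sum (c i) (λ t → E ns (lookup qs i) (update ns x₀ s t))))
                        (trans (cong (c i *_) (E-zeroSum ns (lookup qs i) s x₀)) (ℤP.*-zeroʳ (c i)))

  Interior : ∀ ns → Pt ns → Set
  Interior []       _        = ⊤
  Interior (n ∷ ns) (x , xs) = x ≢ F.zero × Interior ns xs

  E-interior : ∀ ns q {x} → Interior ns x → E ns q x ≡ δ ns q x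
  E-interior []       q        _                = refl
  E-interior (n ∷ ns) (q , qs) {x , xs} (x≢0 , xs-interior) = begin
    (δᶠ q x - δᶠ F.zero x) * E ns qs xs
      ≡⟨ cong₂ (λ z w → (δᶠ q x - z) * w) (Kronecker.δ-≢ F._≟_ (x≢0 ∘ sym)) (E-interior ns qs xs-interior) ⟩
    (δᶠ q x - 0ℤ) * δ ns qs xs
      ≡⟨ cong (_* δ ns qs xs) (ℤP.+-identityʳ (δᶠ q x)) ⟩
    δᶠ q x * δ ns qs xs
      ≡⟨ sym (δ-∷ n ns q qs x xs) ⟩
    δ (n ∷ ns) (q , qs) (x , xs) ∎
    where open ≡-Reasoning

  concatMap-cartesianProduct : ∀ {A B : Set} (xs : List A) (ys : List B) →
                               concatMap (λ x → map (x ,_) ys) xs ≡ cartesianProduct xs ys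
  concatMap-cartesianProduct []       ys = refl
  concatMap-cartesianProduct (x ∷ xs) ys = cong (map (x ,_) ys ++_) (concatMap-cartesianProduct xs ys)

  length-cartesianProduct : ∀ {A B : Set} (xs : List A) (ys : List B) →
                            length (cartesianProduct xs ys) ≡ length xs ℕ.* length ys
  length-cartesianProduct []       ys = refl
  length-cartesianProduct (x ∷ xs) ys =
    trans (length-++ (map (x ,_) ys)) (cong₂ ℕ._+_ (length-map (x ,_) ys) (length-cartesianProduct xs ys))

  allPts-∷ : ∀ n ns → allPts (n ∷ ns) ≡ cartesianProduct (allFin (suc n)) (allPts ns)
  allPts-∷ n ns = concatMap-cartesianProduct (allFin (suc n)) (allPts ns)

  length-allPts : ∀ ns → length (allPts ns) ≡ product (map suc ns)
  length-allPts []       = refl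
  length-allPts (n ∷ ns) = begin
    length (allPts (n ∷ ns))                                ≡⟨ cong length (allPts-∷ n ns) ⟩
    length (cartesianProduct (allFin (suc n)) (allPts ns))  ≡⟨ length-cartesianProduct (allFin (suc n)) (allPts ns) ⟩
    length (allFin (suc n)) ℕ.* length (allPts ns)          ≡⟨ cong₂ ℕ._*_ (length-tabulate {n = suc n} id) (length-allPts ns) ⟩
    suc n ℕ.* product (map suc ns)                          ∎
    where open ≡-Reasoning

  ∈-allPts : ∀ ns (x : Pt ns) → x ∈ allPts ns
  ∈-allPts []       tt       = here refl
  ∈-allPts (n ∷ ns) (x , xs) =
    subst ((x , xs) ∈_) (sym (allPts-∷ n ns)) (∈-cartesianProduct⁺ (∈-allFin x) (∈-allPts ns xs))

  allPts-unique : ∀ ns → Unique (allPts ns)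
  allPts-unique []       = All.[] ∷ []
  allPts-unique (n ∷ ns) = subst Unique (sym (allPts-∷ n ns)) (cartesianProduct⁺ (allFin⁺ (suc n)) (allPts-unique ns))

  length-filter-card : ∀ {ns} (Y : Subset ns) xs →
                       length (filterᵇ Y xs) ≡ foldr (λ x c → if Y x then suc c else c) 0 xs
  length-filter-card Y []       = refl
  length-filter-card Y (x ∷ xs) with Y x
  ... | true  = cong suc (length-filter-card Y xs)
  ... | false = length-filter-card Y xs

  interiorPts : ∀ ns → List (Pt ns)
  interiorPts []       = tt ∷ []
  interiorPts (n ∷ ns) = cartesianProduct (map F.suc (allFin n)) (interiorPts ns)

  length-interiorPts : ∀ ns → length (interiorPts ns) ≡ product ns
  length-interiorPts []       = refl
  length-interiorPts (n ∷ ns) =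
    trans (length-cartesianProduct (map F.suc (allFin n)) (interiorPts ns))
          (cong₂ ℕ._*_ (trans (length-map F.suc (allFin n)) (length-tabulate {n = n} id)) (length-interiorPts ns))

  interiorPts-unique : ∀ ns → Unique (interiorPts ns)
  interiorPts-unique []       = All.[] ∷ []
  interiorPts-unique (n ∷ ns) = cartesianProduct⁺ (Unique.map⁺ FP.suc-injective (allFin⁺ n)) (interiorPts-unique ns)

  ∈-interiorPts⇒Interior : ∀ ns {x} → x ∈ interiorPts ns → Interior ns x
  ∈-interiorPts⇒Interior []       _ = tt
  ∈-interiorPts⇒Interior (n ∷ ns) {x , xs} x∈ with ∈-cartesianProduct⁻ (map F.suc (allFin n)) (interiorPts ns) x∈
  ... | x∈suc , xs∈ with ∈-map⁻ F.suc x∈suc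
  ...   | _ , _ , refl = (λ ()) , ∈-interiorPts⇒Interior ns xs∈

  -- Zero-sum functions from linear dependences

  module Columns (ns : List ℕ) (Y : Subset ns) where

    Xs Bs Ys : List (Pt ns)
    Xs = allPts ns
    Bs = interiorPts ns
    Ys = filterᵇ Y Xs

    a b : ℕ
    a = length Bs
    b = length Ys

    E-columns : Fin a → Fin (length Xs) → ℤ
    E-columns i j = E ns (lookup Bs i) (lookup Xs j)

    δ-columns : Fin b → Fin (length Xs) → ℤ
    δ-columns i j = - δ ns (lookup Ys i) (lookup Xs j)

    columns : Fin (a ℕ.+ b) → Fin (length Xs) → ℤ
    columns = E-columns ++ᵛ δ-columns

    more-columns : product (map suc ns) < card Y ℕ.+ product ns → length Xs < a ℕ.+ b
    more-columns = subst₂ _<_ (sym (length-allPts ns))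
      (trans (ℕP.+-comm (card Y) (product ns))
             (cong₂ ℕ._+_ (sym (length-interiorPts ns)) (sym (length-filter-card Y Xs))))

    module Combination (C : Fin (a ℕ.+ b) → ℤ) (dep : Dependence columns C) where

      G H : Pt ns → ℤ
      G x = sum (λ i → C (i ↑ˡ b) * E ns (lookup Bs i) x)
      H x = sum (λ i → C (a ↑ʳ i) * δ ns (lookup Ys i) x)

      G-zero-sum : ZeroSum G
      G-zero-sum = combination-zeroSum ns Bs (λ i → C (i ↑ˡ b))

      G≡H-on-Xs : ∀ j → G (lookup Xs j) ≡ H (lookup Xs j)
      G≡H-on-Xs j = ℤP.i-j≡0⇒i≡j _ _ (begin
        G (lookup Xs j) - H (lookup Xs j)
          ≡⟨ cong (_+_ (G (lookup Xs j))) (sym (sum-neg (λ i → C (a ↑ʳ i) * δ ns (lookup Ys i) (lookup Xs j)))) ⟩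
        G (lookup Xs j) + sum (λ i → - (C (a ↑ʳ i) * δ ns (lookup Ys i) (lookup Xs j)))
          ≡⟨ cong₂ _+_ (sum-cong-≗ (λ i → cong (C (i ↑ˡ b) *_) (sym (cong (_$ j) (lookup-++ˡ E-columns δ-columns i)))))
                       (sum-cong-≗ (λ i → trans (ℤP.neg-distribʳ-* (C (a ↑ʳ i)) _)
                                                (cong (C (a ↑ʳ i) *_) (sym (cong (_$ j) (lookup-++ʳ E-columns δ-columns i)))))) ⟩
        sum (λ i → C (i ↑ˡ b) * columns (i ↑ˡ b) j) + sum (λ i → C (a ↑ʳ i) * columns (a ↑ʳ i) j)
          ≡⟨ sym (sum-↑ˡ-↑ʳ a (λ t → C t * columns t j)) ⟩
        sum (λ t → C t * columns t j)
          ≡⟨ dep j ⟩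
        0ℤ ∎)
        where open ≡-Reasoning

      G≡H : ∀ x → G x ≡ H x
      G≡H x = subst (λ z → G z ≡ H z) (sym (lookup-index (∈-allPts ns x))) (G≡H-on-Xs (Any.index (∈-allPts ns x)))

      G-on : SupportedOn Y G
      G-on x x∉Y = trans (G≡H x) (Kronecker.sum-δ-∉ _≟Pt_ Ys (λ i → C (a ↑ʳ i)) x∉Ys)
        where x∉Ys = λ x∈Ys → subst T x∉Y (proj₂ (∈-filter⁻ (T? ∘ Y) {xs = Xs} x∈Ys))

      G-value : ∀ t → ∃[ x ] G x ≡ C t
      G-value t with F.splitAt a t in split≡
      ... | inj₁ i = lookup Bs i , (begin
        G (lookup Bs i)
          ≡⟨ sum-cong-≗ (λ k → cong (C (k ↑ˡ b) *_)
                                    (E-interior ns (lookup Bs k) (∈-interiorPts⇒Interior ns (∈-lookup i)))) ⟩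
        sum (λ k → C (k ↑ˡ b) * δ ns (lookup Bs k) (lookup Bs i))
          ≡⟨ Kronecker.sum-δ-lookup _≟Pt_ (interiorPts-unique ns) (λ k → C (k ↑ˡ b)) i ⟩
        C (i ↑ˡ b)
          ≡⟨ cong C (FP.splitAt⁻¹-↑ˡ split≡) ⟩
        C t ∎)
        where open ≡-Reasoning
      ... | inj₂ i = lookup Ys i , (begin
        G (lookup Ys i)
          ≡⟨ G≡H (lookup Ys i) ⟩
        H (lookup Ys i)
          ≡⟨ Kronecker.sum-δ-lookup _≟Pt_ (Unique.filter⁺ (T? ∘ Y) (allPts-unique ns)) (λ k → C (a ↑ʳ k)) i ⟩
        C (a ↑ʳ i)
          ≡⟨ cong C (FP.splitAt⁻¹-↑ʳ split≡) ⟩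
        C t ∎)
        where open ≡-Reasoning

  indivisible-zeroSum : ∀ ns (Y : Subset ns) {L} → 1 < L → product (map suc ns) < card Y ℕ.+ product ns →
                        ∃[ G ] ZeroSum G × SupportedOn Y G × ∃[ x ] ¬ (+ L ∣ G x)
  indivisible-zeroSum ns Y {L} 1<L large =
    from-dependence (primitive-dependence L 1<L (nontrivial-dependence (more-columns large) columns))
    where
    open Columns ns Y
    from-dependence : PrimitiveDependence L columns → ∃[ G ] ZeroSum G × SupportedOn Y G × ∃[ x ] ¬ (+ L ∣ G x)
    from-dependence (C , (t , L∤Ct) , dep) =
      G , G-zero-sum , G-on , proj₁ (G-value t) , L∤Ct ∘ subst (+ L ∣_) (proj₂ (G-value t))
      where open Combination C dep

  basis-card-bound : ∀ {ℓ k₀ ns} → Prime ℓ → {Y Z : Subset ns} → IsBasis {ℓ} {k₀} Y Z →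
                     card Y ≤ product (map suc ns) ∸ product ns
  basis-card-bound {ℓ} {ns = ns} ℓ-prime {Y} Y-basis = ℕP.m+n≤o⇒m≤o∸n (card Y) (ℕP.≮⇒≥ not-too-large)
    where
    refute : ¬ (∃[ G ] ZeroSum G × SupportedOn Y G × ∃[ x ] ¬ (+ ℓ ∣ G x))
    refute (G , G-zero-sum , G-on , x , ℓ∤Gx) = ℓ∤Gx (basis-zeroSum-divisible ℓ-prime Y-basis G-zero-sum G-on x)
    not-too-large : ¬ (product (map suc ns) < card Y ℕ.+ product ns)
    not-too-large = refute ∘ indivisible-zeroSum ns Y (ℕ.nonTrivial⇒n>1 ℓ {{prime⇒nonTrivial ℓ-prime}})

  -- The harmonic bound

  harmonic : List ℕ → ℚ
  harmonic = foldr (λ n acc → ((+ 1) / suc n) Q.+ acc) ((+ 0) / 1)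

  harmonicᵘ : List ℕ → ℚᵘ
  harmonicᵘ []       = 0ℚᵘ
  harmonicᵘ (n ∷ ns) = mkℚᵘ (+ 1) n U.+ harmonicᵘ ns

  toℚᵘ-harmonic : ∀ ns → Q.toℚᵘ (harmonic ns) U.≃ harmonicᵘ ns
  toℚᵘ-harmonic []       = UP.≃-refl
  toℚᵘ-harmonic (n ∷ ns) = UP.≃-trans (QP.toℚᵘ-homo-+ ((+ 1) / suc n) (harmonic ns))
                                     (UP.+-cong (QP.toℚᵘ-fromℚᵘ (mkℚᵘ (+ 1) n)) (toℚᵘ-harmonic ns))

  harmonic-numerator : List ℕ → ℕ
  harmonic-numerator []       = 0
  harmonic-numerator (n ∷ ns) = product (map suc ns) ℕ.+ harmonic-numerator ns ℕ.* suc n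

  ↧-harmonicᵘ : ∀ ns → U.↧ₙ (harmonicᵘ ns) ≡ product (map suc ns)
  ↧-harmonicᵘ []       = refl
  ↧-harmonicᵘ (n ∷ ns) = trans (↧-+ (harmonicᵘ ns)) (cong (suc n ℕ.*_) (↧-harmonicᵘ ns))
    where ↧-+ : ∀ q → U.↧ₙ (mkℚᵘ (+ 1) n U.+ q) ≡ suc n ℕ.* U.↧ₙ q
          ↧-+ (mkℚᵘ _ _) = refl

  ↥-harmonicᵘ : ∀ ns → U.↥ (harmonicᵘ ns) ≡ + harmonic-numerator ns
  ↥-harmonicᵘ []       = refl
  ↥-harmonicᵘ (n ∷ ns) = begin
    U.↥ (harmonicᵘ (n ∷ ns))
      ≡⟨ ↥-+ (harmonicᵘ ns) ⟩
    1ℤ * U.↧ (harmonicᵘ ns) + U.↥ (harmonicᵘ ns) * + suc n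
      ≡⟨ cong₂ (λ d m → 1ℤ * + d + m * + suc n) (↧-harmonicᵘ ns) (↥-harmonicᵘ ns) ⟩
    1ℤ * + product (map suc ns) + + harmonic-numerator ns * + suc n
      ≡⟨ cong₂ _+_ (ℤP.*-identityˡ (+ product (map suc ns))) (sym (ℤP.pos-* (harmonic-numerator ns) (suc n))) ⟩
    + product (map suc ns) + + (harmonic-numerator ns ℕ.* suc n)
      ≡⟨ sym (ℤP.pos-+ (product (map suc ns)) _) ⟩
    + harmonic-numerator (n ∷ ns) ∎
    where
    open ≡-Reasoning
    ↥-+ : ∀ q → U.↥ (mkℚᵘ (+ 1) n U.+ q) ≡ 1ℤ * U.↧ q + U.↥ q * + suc n
    ↥-+ (mkℚᵘ _ _) = refl

  product≤product-suc : ∀ ns → product ns ≤ product (map suc ns)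
  product≤product-suc []       = ℕP.≤-refl
  product≤product-suc (n ∷ ns) = ℕP.*-mono-≤ (ℕP.n≤1+n n) (product≤product-suc ns)

  product-suc∸product≤harmonic-numerator : ∀ ns → product (map suc ns) ∸ product ns ≤ harmonic-numerator ns
  product-suc∸product≤harmonic-numerator []       = z≤n
  product-suc∸product≤harmonic-numerator (n ∷ ns) = begin
    (P₁ ℕ.+ n ℕ.* P₁) ∸ n ℕ.* P₀  ≡⟨ ℕP.+-∸-assoc P₁ (ℕP.*-monoʳ-≤ n (product≤product-suc ns)) ⟩
    P₁ ℕ.+ (n ℕ.* P₁ ∸ n ℕ.* P₀)  ≡⟨ cong (P₁ ℕ.+_) (sym (ℕP.*-distribˡ-∸ n P₁ P₀)) ⟩
    P₁ ℕ.+ n ℕ.* (P₁ ∸ P₀)        ≤⟨ ℕP.+-monoʳ-≤ P₁ (ℕP.*-monoʳ-≤ n (product-suc∸product≤harmonic-numerator ns)) ⟩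
    P₁ ℕ.+ n ℕ.* N                ≤⟨ ℕP.+-monoʳ-≤ P₁ (ℕP.m≤n+m (n ℕ.* N) N) ⟩
    P₁ ℕ.+ suc n ℕ.* N            ≡⟨ cong (P₁ ℕ.+_) (ℕP.*-comm (suc n) N) ⟩
    P₁ ℕ.+ N ℕ.* suc n            ∎
    where
    open ℕP.≤-Reasoning
    P₁ = product (map suc ns)
    P₀ = product ns
    N = harmonic-numerator ns

  harmonic-bound : ∀ ns →
    ((+ (product (map suc ns) ∸ product ns)) / 1) Q.≤ (((+ product (map suc ns)) / 1) Q.* harmonic ns)
  harmonic-bound ns = QP.toℚᵘ-cancel-≤ (begin
    Q.toℚᵘ ((+ D) / 1)                          ≃⟨ QP.toℚᵘ-fromℚᵘ (mkℚᵘ (+ D) 0) ⟩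
    mkℚᵘ (+ D) 0                                ≤⟨ U.*≤* (cross-multiplied (harmonicᵘ ns) (↥-harmonicᵘ ns) (↧-harmonicᵘ ns)) ⟩
    mkℚᵘ (+ P) 0 U.* harmonicᵘ ns               ≃⟨ UP.*-cong (QP.toℚᵘ-fromℚᵘ (mkℚᵘ (+ P) 0)) (toℚᵘ-harmonic ns) ⟨
    Q.toℚᵘ ((+ P) / 1) U.* Q.toℚᵘ (harmonic ns) ≃⟨ QP.toℚᵘ-homo-* ((+ P) / 1) (harmonic ns) ⟨
    Q.toℚᵘ (((+ P) / 1) Q.* harmonic ns)        ∎)
    where
    open UP.≤-Reasoning
    P = product (map suc ns)
    D = P ∸ product ns
    cross-multiplied : ∀ q → U.↥ q ≡ + harmonic-numerator ns → U.↧ₙ q ≡ P →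
                       + D * U.↧ (mkℚᵘ (+ P) 0 U.* q) ℤ.≤ U.↥ (mkℚᵘ (+ P) 0 U.* q) * 1ℤ
    cross-multiplied (mkℚᵘ a d) a≡N d≡P = subst₂ ℤ._≤_ (sym lhs) (sym rhs)
      (ℤ.+≤+ (ℕP.*-monoʳ-≤ P (product-suc∸product≤harmonic-numerator ns)))
      where
      lhs : + D * + (1 ℕ.* suc d) ≡ + (P ℕ.* D)
      lhs = trans (cong (λ z → + D * + z) (trans (ℕP.*-identityˡ (suc d)) d≡P))
                  (trans (sym (ℤP.pos-* D P)) (cong +_ (ℕP.*-comm D P)))
      rhs : + P * a * 1ℤ ≡ + (P ℕ.* harmonic-numerator ns)
      rhs = trans (ℤP.*-identityʳ (+ P * a)) (trans (cong (+ P *_) a≡N) (sym (ℤP.pos-* P (harmonic-numerator ns))))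

open import Data.Rational using (_*_; _+_)

proposition7p8 : (ℓ : ℕ) → Prime ℓ → (k₀ : ℕ) → 1 ≤ k₀ →
    (ns : List ℕ) → 0 < length ns →
    (Y Z : Subset ns) → IsClosed {ℓ} {k₀} Z → IsBasis {ℓ} {k₀} Y Z →
    (card Y ≤ product (map suc ns) ∸ product ns) ×
    (((+ (product (map suc ns) ∸ product ns)) / 1)
      Q.≤ (((+ product (map suc ns)) / 1) * foldr (λ n acc → ((+ 1) / suc n) + acc) ((+ 0) / 1) ns))
proposition7p8 ℓ ℓ-prime k₀ _ ns _ Y Z _ Y-basis = basis-card-bound ℓ-prime Y-basis , harmonic-bound ns
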